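{- Let $\pi=(\pi_1,\ldots,\pi_n)$ be a convex permutation of $\{1,\ldots,n\}$, i.e., $\pi_2-\pi_1\le\pi_3-\pi_2\le\cdots\le\pi_n-\pi_{n-1}$. Then for each $k\le n$, the set $I_k=\{i:\pi_i\le k\}$ (the set of rows of the permutation matrix $P_\pi$ containing a $1$ in one of its first $k$ columns) is an interval of length $k$, i.e., a set of $k$ consecutive integers.
   Context: The permutation matrix $P_\pi$ has a $1$ in position $(i,\pi_i)$ for each $i$ and $0$ elsewhere. -}

module Defs where

open import Data.Nat using (ℕ; suc; _+_; _≤_; _<_)
open import Data.Fin using (Fin; toℕ)
open import Data.Integer as ℤ using (ℤ; +_; _-_)
open import Data.Product using (∃; _×_)
open import Function.Bundles using (_⇔_)
open import Relation.Binary.PropositionalEquality using (_≡_)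
open import Data.Fin.Permutation using (Permutation′; _⟨$⟩ʳ_)

-- Value of π at a 0-based position i, in ℤ, as in the paper's 1-based values:
-- val π i = π_{i+1} ∈ {1,…,n}.
val : ∀ {n} → Permutation′ n → Fin n → ℤ
val π i = + suc (toℕ (π ⟨$⟩ʳ i))

IsConvex : ∀ {n} → Permutation′ n → Set
IsConvex {n} π =
  ∀ (i j l : Fin n) → toℕ j ≡ suc (toℕ i) → toℕ l ≡ suc (toℕ j) →
    (val π j - val π i) ℤ.≤ (val π l - val π j)

IkIsInterval : ∀ {n} → Permutation′ n → ℕ → Set
IkIsInterval {n} π k =
  ∃ λ a → (a + k ≤ n) ×
    (∀ (i : Fin n) → (suc (toℕ (π ⟨$⟩ʳ i)) ≤ k) ⇔ ((a ≤ toℕ i) × (toℕ i < a + k)))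

-- A convex sequence that ascends at some step keeps ascending afterwards, and
-- one that descends at some step was descending before; hence every value lies
-- below one of the two values at any pair of surrounding positions, and all
-- sublevel sets {i : π_i ≤ k} are intervals of positions.  Since π is a
-- permutation, passing from k to k + 1 adjoins exactly one new position to the
-- interval, and an interval plus one point is again an interval only if the
-- point is adjacent to it.
module Submission where

open import Defs
open import Data.Nat using (ℕ; zero; suc; _+_; _≤_; _<_; z≤n; s≤s; s≤s⁻¹; _≤?_; _<?_)
open import Data.Nat.Properties
open import Data.Fin using (Fin; toℕ; fromℕ<)
open import Data.Fin.Properties using (toℕ-injective; toℕ-fromℕ<; fromℕ<-toℕ; fromℕ<-cong; toℕ<n)
open import Data.Fin.Permutation using (Permutation′; _⟨$⟩ʳ_; _⟨$⟩ˡ_; inverseʳ; inverseˡ)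
open import Data.Integer as ℤ using (ℤ; +_; _-_)
import Data.Integer.Properties as ℤ
open import Data.Integer.Solver using (module +-*-Solver)
open import Data.Product using (∃; _×_; _,_; proj₁; proj₂)
open import Data.Sum using (_⊎_; inj₁; inj₂; swap)
open import Data.Empty using (⊥-elim)
open import Function using (_∘_)
open import Function.Bundles using (_⇔_; mk⇔; Equivalence)
open import Function.Construct.Composition using (_⇔-∘_)
open import Function.Construct.Identity using (⇔-id)
open import Function.Construct.Symmetry using (⇔-sym)
open import Data.Sum.Function.Propositional using (_⊎-⇔_)
open import Relation.Nullary using (¬_; Dec; yes; no; contradiction)
open import Relation.Binary.PropositionalEquality

open Equivalence using (to; from)

Interval : ℕ → ℕ → ℕ → Set
Interval a k i = a ≤ i × i < a + k

OrderConvex : (ℕ → Set) → Set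
OrderConvex P = ∀ {i j l} → i ≤ j → j ≤ l → P i → P l → P j

Interval-empty : ∀ {a i} → ¬ Interval a 0 i
Interval-empty {a} (a≤i , i<a) = <-irrefl refl (≤-<-trans a≤i (subst (_ <_) (+-identityʳ a) i<a))

Interval-extendˡ : ∀ {p k i} → Interval p (suc k) i ⇔ (i ≡ p ⊎ Interval (suc p) k i)
Interval-extendˡ {p} {k} {i} = mk⇔ split join
  where
  split : Interval p (suc k) i → i ≡ p ⊎ Interval (suc p) k i
  split (p≤i , i<end) with m≤n⇒m<n∨m≡n p≤i
  ... | inj₁ p<i = inj₂ (p<i , subst (i <_) (+-suc p k) i<end)
  ... | inj₂ refl = inj₁ refl
  join : i ≡ p ⊎ Interval (suc p) k i → Interval p (suc k) i
  join (inj₁ refl) = ≤-refl , m<m+n p (s≤s z≤n)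
  join (inj₂ (p<i , i<end)) = <⇒≤ p<i , subst (i <_) (sym (+-suc p k)) i<end

Interval-extendʳ : ∀ {a k i} → Interval a (suc k) i ⇔ (Interval a k i ⊎ i ≡ a + k)
Interval-extendʳ {a} {k} {i} = mk⇔ split join
  where
  end<end+1 : a + k < a + suc k
  end<end+1 = +-monoʳ-< a (n<1+n k)
  split : Interval a (suc k) i → Interval a k i ⊎ i ≡ a + k
  split (a≤i , i<end) with m≤n⇒m<n∨m≡n (s≤s⁻¹ (subst (i <_) (+-suc a k) i<end))
  ... | inj₁ i<a+k = inj₁ (a≤i , i<a+k)
  ... | inj₂ i≡a+k = inj₂ i≡a+k
  join : Interval a k i ⊎ i ≡ a + k → Interval a (suc k) i
  join (inj₁ (a≤i , i<a+k)) = a≤i , <-trans i<a+k end<end+1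
  join (inj₂ refl) = m≤m+n a k , end<end+1

module _ {P : ℕ → Set} (convex : OrderConvex P) where

  adjoined-point-adjacent : ∀ {a k p} → (∀ i → P i ⇔ (Interval a (suc k) i ⊎ i ≡ p)) →
    ¬ Interval a (suc k) p → suc p ≡ a ⊎ p ≡ a + suc k
  adjoined-point-adjacent {a} {k} {p} P⇔ p∉ = locate (a ≤? p)
    where
    Pp : P p
    Pp = from (P⇔ p) (inj₂ refl)
    Pa : P a
    Pa = from (P⇔ a) (inj₁ (≤-refl , m<m+n a (s≤s z≤n)))
    locate : Dec (a ≤ p) → suc p ≡ a ⊎ p ≡ a + suc k
    locate (no a≰p) with m≤n⇒m<n∨m≡n (≰⇒> a≰p)
    ... | inj₂ p+1≡a = inj₁ p+1≡a
    ... | inj₁ p+1<a with to (P⇔ (suc p)) (convex (n≤1+n p) (<⇒≤ p+1<a) Pp Pa)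
    ...   | inj₁ (a≤p+1 , _) = contradiction p+1<a (≤⇒≯ a≤p+1)
    ...   | inj₂ p+1≡p = contradiction p+1≡p (<⇒≢ (n<1+n p) ∘ sym)
    locate (yes a≤p) with m≤n⇒m<n∨m≡n (≮⇒≥ (p∉ ∘ (a≤p ,_)))
    ... | inj₂ end≡p = inj₂ (sym end≡p)
    ... | inj₁ end<p with to (P⇔ (a + suc k)) (convex (m≤m+n a (suc k)) (<⇒≤ end<p) Pa Pp)
    ...   | inj₁ (_ , end<end) = ⊥-elim (<-irrefl refl end<end)
    ...   | inj₂ end≡p = ⊥-elim (<-irrefl end≡p end<p)

  adjoin-point : ∀ {a k p} → (∀ i → P i ⇔ (Interval a k i ⊎ i ≡ p)) → ¬ Interval a k p →
    ∃ λ a′ → ∀ i → P i ⇔ Interval a′ (suc k) i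
  adjoin-point {k = zero} {p} P⇔ _ = p , λ i → mk⇔
    (λ Pi → from Interval-extendˡ (inj₁ (sole-point (to (P⇔ i) Pi))))
    (λ i∈ → from (P⇔ i) (inj₂ (sole-point (swap (to Interval-extendˡ i∈)))))
    where
    sole-point : ∀ {b i q} → Interval b 0 i ⊎ i ≡ q → i ≡ q
    sole-point (inj₁ i∈) = ⊥-elim (Interval-empty i∈)
    sole-point (inj₂ i≡q) = i≡q
  adjoin-point {a} {suc k} {p} P⇔ p∉ with adjoined-point-adjacent P⇔ p∉
  ... | inj₁ refl = p , λ i → mk⇔
    (λ Pi → from Interval-extendˡ (swap (to (P⇔ i) Pi)))
    (λ i∈ → from (P⇔ i) (swap (to Interval-extendˡ i∈)))
  ... | inj₂ refl = a , λ i → ⇔-sym Interval-extendʳ ⇔-∘ P⇔ i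

ConvexBelow : ℕ → (ℕ → ℕ) → Set
ConvexBelow n g = ∀ m → suc (suc m) < n → g (suc m) + g (suc m) ≤ g (suc (suc m)) + g m

Sublevel : ℕ → (ℕ → ℕ) → ℕ → ℕ → Set
Sublevel n g K i = i < n × g i < K

module ConvexSequence {n : ℕ} {g : ℕ → ℕ} (convex : ConvexBelow n g) where

  ascent-step : ∀ {m} → suc (suc m) < n → g m ≤ g (suc m) → g (suc m) ≤ g (suc (suc m))
  ascent-step {m} lt up =
    +-cancelʳ-≤ (g (suc m)) _ _ (≤-trans (convex m lt) (+-monoʳ-≤ (g (suc (suc m))) up))

  descent-step : ∀ {m} → suc (suc m) < n → g (suc (suc m)) ≤ g (suc m) → g (suc m) ≤ g m
  descent-step {m} lt down =
    +-cancelˡ-≤ (g (suc m)) _ _ (≤-trans (convex m lt) (+-monoˡ-≤ (g m) down))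

  ascent-persists : ∀ {j m} → g j ≤ g (suc j) → j ≤ m → suc m < n → g m ≤ g (suc m)
  ascent-persists {m = zero} up z≤n _ = up
  ascent-persists {m = suc m} up j≤m+1 lt with m≤n⇒m<n∨m≡n j≤m+1
  ... | inj₁ j<m+1 = ascent-step lt (ascent-persists up (s≤s⁻¹ j<m+1) (<-trans (n<1+n _) lt))
  ... | inj₂ refl = up

  rises-after : ∀ {j l} → g j ≤ g (suc j) → suc j ≤ l → l < n → g (suc j) ≤ g l
  rises-after {j} {suc l} up j<l+1 lt with m≤n⇒m<n∨m≡n j<l+1
  ... | inj₁ j+1<l+1 = ≤-trans (rises-after up (s≤s⁻¹ j+1<l+1) (<-trans (n<1+n l) lt))
                               (ascent-persists up (<⇒≤ (s≤s⁻¹ j+1<l+1)) lt)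
  ... | inj₂ refl = ≤-refl

  falls-before : ∀ {i j} → g (suc j) ≤ g j → i ≤ j → suc j < n → g j ≤ g i
  falls-before {j = zero} _ z≤n _ = ≤-refl
  falls-before {i} {suc j} down i≤j+1 lt with m≤n⇒m<n∨m≡n i≤j+1
  ... | inj₁ i<j+1 = ≤-trans (descent-step lt down)
                             (falls-before (descent-step lt down) (s≤s⁻¹ i<j+1) (<-trans (n<1+n _) lt))
  ... | inj₂ refl = ≤-refl

  quasiconvex : ∀ {i j l} → i ≤ j → j ≤ l → l < n → g j ≤ g i ⊎ g j ≤ g l
  quasiconvex {j = j} i≤j j≤l l<n with m≤n⇒m<n∨m≡n j≤l | g j ≤? g (suc j)
  ... | inj₂ refl | _ = inj₂ ≤-refl
  ... | inj₁ j<l | yes up = inj₂ (≤-trans up (rises-after up j<l l<n))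
  ... | inj₁ j<l | no ¬up = inj₁ (falls-before (<⇒≤ (≰⇒> ¬up)) i≤j (≤-<-trans j<l l<n))

  sublevel-convex : ∀ K → OrderConvex (Sublevel n g K)
  sublevel-convex K i≤j j≤l (_ , gi<K) (l<n , gl<K) with quasiconvex i≤j j≤l l<n
  ... | inj₁ gj≤gi = ≤-<-trans j≤l l<n , ≤-<-trans gj≤gi gi<K
  ... | inj₂ gj≤gl = ≤-<-trans j≤l l<n , ≤-<-trans gj≤gl gl<K

sublevel-suc : ∀ {n g k p} → p < n → g p ≡ k → (∀ {i} → i < n → g i ≡ k → i ≡ p) →
  ∀ i → Sublevel n g (suc k) i ⇔ (Sublevel n g k i ⊎ i ≡ p)
sublevel-suc {n} {g} {k} {p} p<n gp≡k unique i = mk⇔ split join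
  where
  split : Sublevel n g (suc k) i → Sublevel n g k i ⊎ i ≡ p
  split (i<n , gi<k+1) with m≤n⇒m<n∨m≡n (s≤s⁻¹ gi<k+1)
  ... | inj₁ gi<k = inj₁ (i<n , gi<k)
  ... | inj₂ gi≡k = inj₂ (unique i<n gi≡k)
  join : Sublevel n g k i ⊎ i ≡ p → Sublevel n g (suc k) i
  join (inj₁ (i<n , gi<k)) = i<n , m<n⇒m<1+n gi<k
  join (inj₂ refl) = p<n , s≤s (≤-reflexive gp≡k)

sublevel-interval : ∀ {n g} → ConvexBelow n g →
  (∀ {k} → k < n → ∃ λ p → p < n × g p ≡ k) →
  (∀ {i j} → i < n → j < n → g i ≡ g j → i ≡ j) →
  ∀ k → k ≤ n → ∃ λ a → a + k ≤ n × (∀ i → Sublevel n g k i ⇔ Interval a k i)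
sublevel-interval _ _ _ zero _ = 0 , z≤n , λ i → mk⇔ (λ { (_ , ()) }) (⊥-elim ∘ Interval-empty)
sublevel-interval {n} {g} convex onto injective (suc k) k<n
  with sublevel-interval convex onto injective k (<⇒≤ k<n) | onto k<n
... | a , _ , sublevel⇔ | p , p<n , gp≡k
  with adjoin-point (ConvexSequence.sublevel-convex convex (suc k)) step p∉
  where
  step : ∀ i → Sublevel n g (suc k) i ⇔ (Interval a k i ⊎ i ≡ p)
  step i = (sublevel⇔ i ⊎-⇔ ⇔-id _) ⇔-∘ sublevel-suc p<n gp≡k
             (λ i<n gi≡k → injective i<n p<n (trans gi≡k (sym gp≡k))) i
  p∉ : ¬ Interval a k p
  p∉ p∈ = <-irrefl gp≡k (proj₂ (from (sublevel⇔ p) p∈))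
... | a′ , sublevel⇔′ = a′ , bound , sublevel⇔′
  where
  bound : a′ + suc k ≤ n
  bound = subst (_≤ n) (sym (+-suc a′ k))
            (proj₁ (from (sublevel⇔′ (a′ + k)) (from Interval-extendʳ (inj₂ refl))))

sub-≤-sub⇒+-≤-+ : ∀ (x y z : ℤ) → x - y ℤ.≤ z - x → x ℤ.+ x ℤ.≤ z ℤ.+ y
sub-≤-sub⇒+-≤-+ x y z h = subst₂ ℤ._≤_ left right (ℤ.+-monoˡ-≤ (x ℤ.+ y) h)
  where
  open +-*-Solver
  left : (x - y) ℤ.+ (x ℤ.+ y) ≡ x ℤ.+ x
  left = solve 2 (λ x y → (x :- y) :+ (x :+ y) := x :+ x) refl x y
  right : (z - x) ℤ.+ (x ℤ.+ y) ≡ z ℤ.+ y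
  right = solve 3 (λ x y z → (z :- x) :+ (x :+ y) := z :+ y) refl x y z

+-≤-+-from-sub : ∀ a b c → + b - + a ℤ.≤ + c - + b → b + b ≤ c + a
+-≤-+-from-sub a b c h = ℤ.drop‿+≤+
  (subst₂ ℤ._≤_ (sym (ℤ.pos-+ b b)) (sym (ℤ.pos-+ c a)) (sub-≤-sub⇒+-≤-+ (+ b) (+ a) (+ c) h))

suc-minus-suc : ∀ m n → + suc m - + suc n ≡ + m - + n
suc-minus-suc m n = trans (ℤ.[1+m]⊖[1+n]≡m⊖n m n) (sym (ℤ.m-n≡m⊖n m n))

-- Positions m ≥ n get the junk value 0; only positions below n are ever inspected.
values : ∀ {n} → Permutation′ n → ℕ → ℕ
values {n} π m with m <? n
... | yes m<n = toℕ (π ⟨$⟩ʳ fromℕ< m<n)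
... | no _ = 0

module _ {n : ℕ} (π : Permutation′ n) where

  values-fromℕ< : ∀ {m} (m<n : m < n) → values π m ≡ toℕ (π ⟨$⟩ʳ fromℕ< m<n)
  values-fromℕ< {m} m<n with m <? n
  ... | yes m<n′ = cong (toℕ ∘ (π ⟨$⟩ʳ_)) (fromℕ<-cong m m refl m<n′ m<n)
  ... | no m≮n = contradiction m<n m≮n

  values-toℕ : ∀ i → values π (toℕ i) ≡ toℕ (π ⟨$⟩ʳ i)
  values-toℕ i = trans (values-fromℕ< (toℕ<n i)) (cong (toℕ ∘ (π ⟨$⟩ʳ_)) (fromℕ<-toℕ i _))

  values-onto : ∀ {k} → k < n → ∃ λ p → p < n × values π p ≡ k
  values-onto k<n = toℕ p , toℕ<n p , trans (values-toℕ p) (trans (cong toℕ (inverseʳ π)) (toℕ-fromℕ< k<n))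
    where
    p : Fin n
    p = π ⟨$⟩ˡ fromℕ< k<n

  values-injective : ∀ {i j} → i < n → j < n → values π i ≡ values π j → i ≡ j
  values-injective {i} {j} i<n j<n eq = begin
    i                             ≡⟨ toℕ-fromℕ< i<n ⟨
    toℕ (fromℕ< i<n)              ≡⟨ cong toℕ (inverseˡ π) ⟨
    toℕ (π ⟨$⟩ˡ (π ⟨$⟩ʳ fromℕ< i<n)) ≡⟨ cong (toℕ ∘ (π ⟨$⟩ˡ_)) (toℕ-injective π-eq) ⟩
    toℕ (π ⟨$⟩ˡ (π ⟨$⟩ʳ fromℕ< j<n)) ≡⟨ cong toℕ (inverseˡ π) ⟩
    toℕ (fromℕ< j<n)              ≡⟨ toℕ-fromℕ< j<n ⟩
    j                             ∎
    where
    open ≡-Reasoning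
    π-eq : toℕ (π ⟨$⟩ʳ fromℕ< i<n) ≡ toℕ (π ⟨$⟩ʳ fromℕ< j<n)
    π-eq = trans (sym (values-fromℕ< i<n)) (trans eq (values-fromℕ< j<n))

  IsConvex⇒ConvexBelow : IsConvex π → ConvexBelow n (values π)
  IsConvex⇒ConvexBelow convex m m+2<n =
    subst₂ _≤_ (sym (cong₂ _+_ (values-fromℕ< m+1<n) (values-fromℕ< m+1<n)))
               (sym (cong₂ _+_ (values-fromℕ< m+2<n) (values-fromℕ< m<n)))
               (+-≤-+-from-sub (at i) (at j) (at l)
                 (subst₂ ℤ._≤_ (suc-minus-suc (at j) (at i)) (suc-minus-suc (at l) (at j))
                   (convex i j l (consecutive m<n) (consecutive m+1<n))))
    where
    at : Fin n → ℕ
    at x = toℕ (π ⟨$⟩ʳ x)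
    m+1<n : suc m < n
    m+1<n = <-trans (n<1+n _) m+2<n
    m<n : m < n
    m<n = <-trans (n<1+n m) m+1<n
    i j l : Fin n
    i = fromℕ< m<n
    j = fromℕ< m+1<n
    l = fromℕ< m+2<n
    consecutive : ∀ {k} (k<n : k < n) .{k+1<n : suc k < n} → toℕ (fromℕ< k+1<n) ≡ suc (toℕ (fromℕ< k<n))
    consecutive k<n {k+1<n} = trans (toℕ-fromℕ< k+1<n) (cong suc (sym (toℕ-fromℕ< k<n)))

lemma4p2 : (n : ℕ) (π : Permutation′ n) → IsConvex π →
    (k : ℕ) → k ≤ n → IkIsInterval π k
lemma4p2 n π convex k k≤n with sublevel-interval (IsConvex⇒ConvexBelow π convex)
                                 (values-onto π) (values-injective π) k k≤n
... | a , bound , sublevel⇔ = a , bound , λ i → sublevel⇔ (toℕ i) ⇔-∘ mk⇔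
  (λ πi<k → toℕ<n i , subst (_< k) (sym (values-toℕ π i)) πi<k)
  (λ (_ , πi<k) → subst (_< k) (values-toℕ π i) πi<k)
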